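{- Let $G$ be an abelian group and let $A\subseteq G$ be a subset with $|A|=4$ and $|2\wedge A|=|A|$. Then $A$ is the union of two cosets of a subgroup of $G$ of order $2$.
   Context: $2\wedge A:=\{x+y: x,y\in A,\ x\neq y\}$. -}

module Defs where

open import Level using (Level; _⊔_; suc)
open import Algebra.Bundles using (AbelianGroup)
open import Data.Fin using (Fin)
open import Data.Product using (Σ; ∃; _×_; _,_)
open import Data.Sum using (_⊎_)
open import Relation.Nullary using (¬_)
open import Function.Bundles using (_⇔_)

module _ {c ℓ : Level} (G : AbelianGroup c ℓ) where
  open AbelianGroup G

  -- subsets of G are predicates on the carrier (respecting ≈ where needed)
  Subset : Set (suc (c ⊔ ℓ))
  Subset = Carrier → Set (c ⊔ ℓ)

  HasCard : Subset → (n : _) → Set (c ⊔ ℓ)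
  HasCard S n =
    (∀ {x y} → x ≈ y → S x → S y) ×
    Σ (Fin n → Carrier) λ e →
      (∀ i j → e i ≈ e j → i ≡ j) ×
      (∀ i → S (e i)) ×
      (∀ x → S x → ∃ λ i → x ≈ e i)
    where open import Relation.Binary.PropositionalEquality using (_≡_)

  2∧ : Subset → Subset
  2∧ A z = Σ Carrier λ x → Σ Carrier λ y →
             A x × A y × ¬ (x ≈ y) × z ≈ x ∙ y

  IsSubgroup : Subset → Set (c ⊔ ℓ)
  IsSubgroup H =
    (∀ {x y} → x ≈ y → H x → H y) ×
    H ε ×
    (∀ {x y} → H x → H y → H (x ∙ y)) ×
    (∀ {x} → H x → H (x ⁻¹))

  Coset : Carrier → Subset → Subset
  Coset x H g = Σ Carrier λ h → H h × g ≈ x ∙ h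

  UnionOfTwoCosetsOfOrder2Subgroup : Subset → Set (suc (c ⊔ ℓ))
  UnionOfTwoCosetsOfOrder2Subgroup A =
    Σ Subset λ H → IsSubgroup H × HasCard H 2 ×
    Σ Carrier λ x → Σ Carrier λ y →
      ∀ g → A g ⇔ (Coset x H g ⊎ Coset y H g)

-- The six sums a+b, c+d, a+c, b+d, a+d, b+c all lie in 2∧A, and two
-- of them sharing a summand are different (cancellation).  So only the three
-- "complementary" pairs (a+b, c+d), (a+c, b+d), (a+d, b+c) can coincide, and
-- since 2∧A has just four elements, at least two of them do: after relabelling
-- b, c, d cyclically, A is a "rhombus": a+b = c+d and a+c = b+d.
--
-- Structure.  In a rhombus, t = b - c satisfies 2t = 0, t ≠ 0, a = d + t and
-- b = c + t.  Hence H = {0, t} is a subgroup of order 2 and A = (d + H) ∪ (c + H).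
module Submission where

open import Defs
open import Level using (Level; Lift; lift)
open import Algebra.Bundles using (AbelianGroup)
open import Data.Fin using (Fin; zero; suc; _≟_)
open import Data.Fin.Properties using (all?)
open import Data.Fin.Permutation
  using (Permutation′; _⟨$⟩ʳ_; _⟨$⟩ˡ_; transpose; _∘ₚ_)
  renaming (inverseˡ to from-to; inverseʳ to to-from)
open import Data.Product using (_×_; _,_; ∃; proj₁; proj₂; swap)
open import Data.Empty using (⊥-elim)
open import Data.Sum using (_⊎_; inj₁; inj₂)
open import Data.Sum.Function.Propositional using (_⊎-⇔_)
open import Relation.Nullary using (Dec; yes; no)
open import Relation.Nullary.Decidable using (¬?; _→-dec_; toWitness)
open import Relation.Binary.PropositionalEquality as ≡ using (_≡_; _≢_)
open import Function.Bundles using (_⇔_; mk⇔)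
open import Function.Construct.Composition using (_⇔-∘_)
open import Function.Construct.Symmetry using (⇔-sym)

pattern f0 = zero
pattern f1 = suc zero
pattern f2 = suc (suc zero)
pattern f3 = suc (suc (suc zero))

FourthElement : (w x y z v : Fin 4) → Set
FourthElement w x y z v =
  w ≢ x → w ≢ y → w ≢ z → x ≢ y → x ≢ z → y ≢ z →
  v ≢ w → v ≢ x → v ≢ y → v ≡ z

fourth-element? : ∀ w x y z v → Dec (FourthElement w x y z v)
fourth-element? w x y z v =
  w ≢? x →-dec w ≢? y →-dec w ≢? z →-dec x ≢? y →-dec x ≢? z →-dec y ≢? z →-dec
  v ≢? w →-dec v ≢? x →-dec v ≢? y →-dec v ≟ z
  where
  _≢?_ : (i j : Fin 4) → Dec (i ≢ j)
  i ≢? j = ¬? (i ≟ j)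

-- Checked exhaustively over all 4^5 assignments.
abstract
  fourth-element : ∀ w x y z v → FourthElement w x y z v
  fourth-element = toWitness {a? = all? λ w → all? λ x → all? λ y → all? λ z → all? λ v →
                                     fourth-element? w x y z v} _

-- The relabelling (b, c, d) ↦ (c, d, b) of a four-element enumeration (a, b, c, d).
rotate : Permutation′ 4
rotate = transpose f2 f3 ∘ₚ transpose f1 f2

module _ {o ℓ : Level} (G : AbelianGroup o ℓ) where
  open AbelianGroup G
  open import Algebra.Properties.AbelianGroup G using (ε⁻¹≈ε; inverseʳ-unique; x∙y⁻¹≈ε⇒x≈y; ∙-cancelˡ; ∙-cancelʳ)
  open import Algebra.Properties.CommutativeSemigroup commutativeSemigroup using (interchange)
  open import Relation.Binary.Reasoning.Setoid setoid

  elem : ∀ {S n} → HasCard G S n → Fin n → Carrier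
  elem (_ , e , _) = e

  elem-≉ : ∀ {S n} (card : HasCard G S n) i j → i ≢ j → elem card i ≉ elem card j
  elem-≉ (_ , e , inj , _) i j i≢j ei≈ej = i≢j (inj i j ei≈ej)

  position : ∀ {S n x} → HasCard G S n → S x → Fin n
  position (_ , _ , _ , _ , cover) Sx = proj₁ (cover _ Sx)

  same-position : ∀ {S n} (card : HasCard G S n) {x y} (Sx : S x) (Sy : S y) →
                  position card Sx ≡ position card Sy → x ≈ y
  same-position (_ , _ , _ , _ , cover) {x} {y} Sx Sy eq with cover x Sx | cover y Sy
  same-position _ Sx Sy ≡.refl | i , x≈ei | .i , y≈ei = trans x≈ei (sym y≈ei)

  ≈⇒same-position : ∀ {S n} (card : HasCard G S n) {x y} (Sx : S x) (Sy : S y) →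
                    x ≈ y → position card Sx ≡ position card Sy
  ≈⇒same-position (_ , _ , inj , _ , cover) {x} {y} Sx Sy x≈y with cover x Sx | cover y Sy
  ... | i , x≈ei | j , y≈ej = inj i j (trans (sym x≈ei) (trans x≈y y≈ej))

  ≈-dec : ∀ {S n x y} → HasCard G S n → S x → S y → Dec (x ≈ y)
  ≈-dec card Sx Sy with position card Sx ≟ position card Sy
  ... | yes same = yes (same-position card Sx Sy same)
  ... | no differ = no λ x≈y → differ (≈⇒same-position card Sx Sy x≈y)

  fourth-member : ∀ {S w x y z v} → HasCard G S 4 →
                  S w → S x → S y → S z → S v →
                  w ≉ x → w ≉ y → w ≉ z → x ≉ y → x ≉ z → y ≉ z →
                  v ≉ w → v ≉ x → v ≉ y → v ≈ z
  fourth-member {S} card Sw Sx Sy Sz Sv w≉x w≉y w≉z x≉y x≉z y≉z v≉w v≉x v≉y =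
    same-position card Sv Sz
      (fourth-element (pos Sw) (pos Sx) (pos Sy) (pos Sz) (pos Sv)
        (apart Sw Sx w≉x) (apart Sw Sy w≉y) (apart Sw Sz w≉z)
        (apart Sx Sy x≉y) (apart Sx Sz x≉z) (apart Sy Sz y≉z)
        (apart Sv Sw v≉w) (apart Sv Sx v≉x) (apart Sv Sy v≉y))
    where
    pos : ∀ {p} → S p → Fin 4
    pos = position card
    apart : ∀ {p q} (Sp : S p) (Sq : S q) → p ≉ q → pos Sp ≢ pos Sq
    apart Sp Sq p≉q same = p≉q (same-position card Sp Sq same)

  reindex : ∀ {S n} → Permutation′ n → HasCard G S n → HasCard G S n
  reindex {S} {n} π (resp , e , inj , mem , cover) = resp , e′ , inj′ , (λ i → mem (π ⟨$⟩ʳ i)) , cover′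
    where
    e′ : Fin n → Carrier
    e′ i = e (π ⟨$⟩ʳ i)
    inj′ : ∀ i j → e′ i ≈ e′ j → i ≡ j
    inj′ i j eπi≈eπj = ≡.trans (≡.sym (from-to π))
                         (≡.trans (≡.cong (π ⟨$⟩ˡ_) (inj _ _ eπi≈eπj)) (from-to π))
    cover′ : ∀ x → S x → ∃ λ i → x ≈ e′ i
    cover′ x Sx with cover x Sx
    ... | i , x≈ei = π ⟨$⟩ˡ i , ≡.subst (λ k → x ≈ e k) (≡.sym (to-from π)) x≈ei

  ⟨_⟩₂ : Carrier → Subset G
  ⟨ t ⟩₂ g = Lift o (g ≈ ε ⊎ g ≈ t)

  pair-resp : ∀ {t x y} → x ≈ y → ⟨ t ⟩₂ x → ⟨ t ⟩₂ y
  pair-resp x≈y (lift (inj₁ x≈ε)) = lift (inj₁ (trans (sym x≈y) x≈ε))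
  pair-resp x≈y (lift (inj₂ x≈t)) = lift (inj₂ (trans (sym x≈y) x≈t))

  involution-self-inverse : ∀ {t} → t ∙ t ≈ ε → t ⁻¹ ≈ t
  involution-self-inverse {t} t∙t≈ε = sym (inverseʳ-unique t t t∙t≈ε)

  involution-subgroup : ∀ {t} → t ∙ t ≈ ε → IsSubgroup G ⟨ t ⟩₂
  involution-subgroup {t} t∙t≈ε = pair-resp , lift (inj₁ refl) , closed , inverse-closed
    where
    closed : ∀ {x y} → ⟨ t ⟩₂ x → ⟨ t ⟩₂ y → ⟨ t ⟩₂ (x ∙ y)
    closed (lift (inj₁ x≈ε)) (lift (inj₁ y≈ε)) = lift (inj₁ (trans (∙-cong x≈ε y≈ε) (identityˡ ε)))
    closed (lift (inj₁ x≈ε)) (lift (inj₂ y≈t)) = lift (inj₂ (trans (∙-cong x≈ε y≈t) (identityˡ t)))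
    closed (lift (inj₂ x≈t)) (lift (inj₁ y≈ε)) = lift (inj₂ (trans (∙-cong x≈t y≈ε) (identityʳ t)))
    closed (lift (inj₂ x≈t)) (lift (inj₂ y≈t)) = lift (inj₁ (trans (∙-cong x≈t y≈t) t∙t≈ε))
    inverse-closed : ∀ {x} → ⟨ t ⟩₂ x → ⟨ t ⟩₂ (x ⁻¹)
    inverse-closed (lift (inj₁ x≈ε)) = lift (inj₁ (trans (⁻¹-cong x≈ε) ε⁻¹≈ε))
    inverse-closed (lift (inj₂ x≈t)) =
      lift (inj₂ (trans (⁻¹-cong x≈t) (involution-self-inverse t∙t≈ε)))

  pair-card : ∀ {t} → t ≉ ε → HasCard G ⟨ t ⟩₂ 2
  pair-card {t} t≉ε = pair-resp , e , inj , mem , cover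
    where
    e : Fin 2 → Carrier
    e f0 = ε
    e f1 = t
    inj : ∀ i j → e i ≈ e j → i ≡ j
    inj f0 f0 _   = ≡.refl
    inj f0 f1 ε≈t = ⊥-elim (t≉ε (sym ε≈t))
    inj f1 f0 t≈ε = ⊥-elim (t≉ε t≈ε)
    inj f1 f1 _   = ≡.refl
    mem : ∀ i → ⟨ t ⟩₂ (e i)
    mem f0 = lift (inj₁ refl)
    mem f1 = lift (inj₂ refl)
    cover : ∀ x → ⟨ t ⟩₂ x → ∃ λ i → x ≈ e i
    cover x (lift (inj₁ x≈ε)) = f0 , x≈ε
    cover x (lift (inj₂ x≈t)) = f1 , x≈t

  coset-of-pair : ∀ x t g → Coset G x ⟨ t ⟩₂ g ⇔ (g ≈ x ⊎ g ≈ x ∙ t)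
  coset-of-pair x t g = mk⇔ to from
    where
    to : Coset G x ⟨ t ⟩₂ g → g ≈ x ⊎ g ≈ x ∙ t
    to (h , lift (inj₁ h≈ε) , g≈xh) = inj₁ (trans g≈xh (trans (∙-congˡ h≈ε) (identityʳ x)))
    to (h , lift (inj₂ h≈t) , g≈xh) = inj₂ (trans g≈xh (∙-congˡ h≈t))
    from : g ≈ x ⊎ g ≈ x ∙ t → Coset G x ⟨ t ⟩₂ g
    from (inj₁ g≈x)  = ε , lift (inj₁ refl) , trans g≈x (sym (identityʳ x))
    from (inj₂ g≈xt) = t , lift (inj₂ refl) , g≈xt

  move-summand : ∀ {x y z w} → x ∙ y ≈ z ∙ w → x ≈ z ∙ (w ∙ y ⁻¹)
  move-summand {x} {y} {z} {w} xy≈zw = begin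
    x                ≈⟨ identityʳ x ⟨
    x ∙ ε            ≈⟨ ∙-congˡ (inverseʳ y) ⟨
    x ∙ (y ∙ y ⁻¹)   ≈⟨ assoc x y (y ⁻¹) ⟨
    (x ∙ y) ∙ y ⁻¹   ≈⟨ ∙-congʳ xy≈zw ⟩
    (z ∙ w) ∙ y ⁻¹   ≈⟨ assoc z w (y ⁻¹) ⟩
    z ∙ (w ∙ y ⁻¹)   ∎

  equal-doubles : ∀ {x y} → x ∙ x ≈ y ∙ y → (x ∙ y ⁻¹) ∙ (x ∙ y ⁻¹) ≈ ε
  equal-doubles {x} {y} xx≈yy = begin
    (x ∙ y ⁻¹) ∙ (x ∙ y ⁻¹)   ≈⟨ interchange x (y ⁻¹) x (y ⁻¹) ⟩
    (x ∙ x) ∙ (y ⁻¹ ∙ y ⁻¹)   ≈⟨ ∙-congʳ xx≈yy ⟩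
    (y ∙ y) ∙ (y ⁻¹ ∙ y ⁻¹)   ≈⟨ interchange y y (y ⁻¹) (y ⁻¹) ⟩
    (y ∙ y ⁻¹) ∙ (y ∙ y ⁻¹)   ≈⟨ ∙-cong (inverseʳ y) (inverseʳ y) ⟩
    ε ∙ ε                     ≈⟨ identityˡ ε ⟩
    ε                         ∎

  Rhombus : Carrier → Carrier → Carrier → Carrier → Set ℓ
  Rhombus a b c d = a ∙ b ≈ c ∙ d × a ∙ c ≈ b ∙ d

  rhombus-doubles : ∀ {a b c d} → Rhombus a b c d → b ∙ b ≈ c ∙ c
  rhombus-doubles {a} {b} {c} {d} (ab≈cd , ac≈bd) = ∙-cancelˡ (a ∙ d) (b ∙ b) (c ∙ c) (begin
    (a ∙ d) ∙ (b ∙ b)   ≈⟨ interchange a d b b ⟩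
    (a ∙ b) ∙ (d ∙ b)   ≈⟨ ∙-cong ab≈cd (trans (comm d b) (sym ac≈bd)) ⟩
    (c ∙ d) ∙ (a ∙ c)   ≈⟨ comm (c ∙ d) (a ∙ c) ⟩
    (a ∙ c) ∙ (c ∙ d)   ≈⟨ ∙-congˡ (comm c d) ⟩
    (a ∙ c) ∙ (d ∙ c)   ≈⟨ interchange a c d c ⟩
    (a ∙ d) ∙ (c ∙ c)   ∎)

  rhombus-translation : ∀ {a b c d} → Rhombus a b c d →
                        let t = b ∙ c ⁻¹ in t ∙ t ≈ ε × a ≈ d ∙ t × b ≈ c ∙ t
  rhombus-translation r@(_ , ac≈bd) =
    equal-doubles (rhombus-doubles r) ,
    move-summand (trans ac≈bd (comm _ _)) ,
    move-summand (comm _ _)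

  -- A four-element set enumerated as a rhombus (a, b, c, d) with b ≠ c is the
  -- union of the cosets d + {ε, t} = {d, a} and c + {ε, t} = {c, b}, t = b - c.
  rhombus⇒cosets : ∀ {A} (card : HasCard G A 4) →
                   Rhombus (elem card f0) (elem card f1) (elem card f2) (elem card f3) →
                   UnionOfTwoCosetsOfOrder2Subgroup G A
  rhombus⇒cosets {A} card@(resp , e , _ , mem , cover) r =
    ⟨ t ⟩₂ , involution-subgroup t∙t≈ε , pair-card t≉ε , d , c ,
    λ g → ⇔-sym (coset-of-pair d t g ⊎-⇔ coset-of-pair c t g) ⇔-∘ split g
    where
    a b c d t : Carrier
    a = e f0
    b = e f1
    c = e f2
    d = e f3
    t = b ∙ c ⁻¹
    t∙t≈ε : t ∙ t ≈ ε
    t∙t≈ε = proj₁ (rhombus-translation r)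
    a≈dt : a ≈ d ∙ t
    a≈dt = proj₁ (proj₂ (rhombus-translation r))
    b≈ct : b ≈ c ∙ t
    b≈ct = proj₂ (proj₂ (rhombus-translation r))
    t≉ε : t ≉ ε
    t≉ε t≈ε = elem-≉ card f1 f2 (λ ()) (x∙y⁻¹≈ε⇒x≈y b c t≈ε)
    split : ∀ g → A g ⇔ ((g ≈ d ⊎ g ≈ d ∙ t) ⊎ (g ≈ c ⊎ g ≈ c ∙ t))
    split g = mk⇔ to from
      where
      to : A g → (g ≈ d ⊎ g ≈ d ∙ t) ⊎ (g ≈ c ⊎ g ≈ c ∙ t)
      to Ag with cover g Ag
      ... | f0 , g≈a = inj₁ (inj₂ (trans g≈a a≈dt))
      ... | f1 , g≈b = inj₂ (inj₂ (trans g≈b b≈ct))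
      ... | f2 , g≈c = inj₂ (inj₁ g≈c)
      ... | f3 , g≈d = inj₁ (inj₁ g≈d)
      from : (g ≈ d ⊎ g ≈ d ∙ t) ⊎ (g ≈ c ⊎ g ≈ c ∙ t) → A g
      from (inj₁ (inj₁ g≈d))  = resp (sym g≈d) (mem f3)
      from (inj₁ (inj₂ g≈dt)) = resp (sym (trans g≈dt (sym a≈dt))) (mem f0)
      from (inj₂ (inj₁ g≈c))  = resp (sym g≈c) (mem f2)
      from (inj₂ (inj₂ g≈ct)) = resp (sym (trans g≈ct (sym b≈ct))) (mem f1)

  ≉-∙ˡ : ∀ {x y z} → y ≉ z → x ∙ y ≉ x ∙ z
  ≉-∙ˡ {x} {y} {z} y≉z xy≈xz = y≉z (∙-cancelˡ x y z xy≈xz)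

  ≉-∙ʳ : ∀ {x y z} → x ≉ y → x ∙ z ≉ y ∙ z
  ≉-∙ʳ {x} {y} {z} x≉y xz≈yz = x≉y (∙-cancelʳ z x y xz≈yz)

  ≉-∙-cross : ∀ {x y z} → y ≉ z → x ∙ y ≉ z ∙ x
  ≉-∙-cross {x} {y} {z} y≉z xy≈zx = ≉-∙ˡ y≉z (trans xy≈zx (comm z x))

  sum-at : ∀ {A n} (card : HasCard G A n) i j → i ≢ j → 2∧ G A (elem card i ∙ elem card j)
  sum-at card@(_ , e , _ , mem , _) i j i≢j =
    e i , e j , mem i , mem j , elem-≉ card i j i≢j , refl

  module _ {A : Subset G} (card₂ : HasCard G (2∧ G A) 4) where

    -- For an enumeration (a, b, c, d) of A: if a + b ≠ c + d, then a + c = d + b,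
    -- because a + b, c + d, a + d, a + c are four distinct elements of 2∧A and
    -- d + b differs from the first three.
    cross-sum : (card : HasCard G A 4) →
                elem card f0 ∙ elem card f1 ≉ elem card f2 ∙ elem card f3 →
                elem card f0 ∙ elem card f2 ≈ elem card f3 ∙ elem card f1
    cross-sum card ab≉cd = sym (
      fourth-member card₂ (sum f0 f1 λ ()) (sum f2 f3 λ ()) (sum f0 f3 λ ()) (sum f0 f2 λ ())
        (sum f3 f1 λ ())
        ab≉cd (≉-∙ˡ b≉d) (≉-∙ˡ b≉c) (≉-∙ʳ c≉a) (≉-∙-cross d≉a) (≉-∙ˡ d≉c)
        (≉-∙ʳ d≉a) (≉-∙-cross b≉c) (≉-∙-cross b≉a))
      where
      sum : ∀ i j → i ≢ j → 2∧ G A (elem card i ∙ elem card j)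
      sum = sum-at card
      a b c d : Carrier
      a = elem card f0
      b = elem card f1
      c = elem card f2
      d = elem card f3
      b≉a : b ≉ a
      b≉a = elem-≉ card f1 f0 λ ()
      b≉c : b ≉ c
      b≉c = elem-≉ card f1 f2 λ ()
      b≉d : b ≉ d
      b≉d = elem-≉ card f1 f3 λ ()
      c≉a : c ≉ a
      c≉a = elem-≉ card f2 f0 λ ()
      d≉a : d ≉ a
      d≉a = elem-≉ card f3 f0 λ ()
      d≉c : d ≉ c
      d≉c = elem-≉ card f3 f2 λ ()

    complementary : (card : HasCard G A 4) →
                    elem card f0 ∙ elem card f1 ≉ elem card f2 ∙ elem card f3 →
                    Rhombus (elem card f0) (elem card f2) (elem card f3) (elem card f1)
    complementary card ab≉cd =
      cross-sum card ab≉cd ,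
      cross-sum (reindex (transpose f2 f3) card) (λ ab≈dc → ab≉cd (trans ab≈dc (comm _ _)))

    rhombus-trichotomy : (card : HasCard G A 4) →
                         let a = elem card f0; b = elem card f1
                             c = elem card f2; d = elem card f3
                         in Rhombus a b c d ⊎ Rhombus a c d b ⊎ Rhombus a d b c
    rhombus-trichotomy card
      with ≈-dec card₂ (sum-at card f0 f1 λ ()) (sum-at card f2 f3 λ ())
    ... | no ab≉cd = inj₂ (inj₁ (complementary card ab≉cd))
    ... | yes ab≈cd
      with ≈-dec card₂ (sum-at card f0 f2 λ ()) (sum-at card f1 f3 λ ())
    ...   | yes ac≈bd = inj₁ (ab≈cd , ac≈bd)
    ...   | no ac≉bd = inj₂ (inj₂ (swap (complementary (reindex (transpose f1 f2) card) ac≉bd)))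

lemma8 : {c ℓ : Level} (G : AbelianGroup c ℓ) (A : Subset G) →
         HasCard G A 4 → HasCard G (2∧ G A) 4 →
         UnionOfTwoCosetsOfOrder2Subgroup G A
lemma8 G A card card₂ with rhombus-trichotomy G card₂ card
... | inj₁ abcd = rhombus⇒cosets G card abcd
... | inj₂ (inj₁ acdb) = rhombus⇒cosets G (reindex G rotate card) acdb
... | inj₂ (inj₂ adbc) = rhombus⇒cosets G (reindex G (rotate ∘ₚ rotate) card) adbc
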